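{- Let $1\le t\le f\le n$ be integers, let $T$ be an intersection type of size $t$, let $F$ be a $T$-flag of size $f$, and let $\Theta:[t]\to[n]$ be an injective map. Let $\boldsymbol{\lambda}=(n-t,1^t)$ and let $\tau_{\boldsymbol{\lambda}}$ be any tableau of shape $\boldsymbol{\lambda}$ whose first row (of length $n-t$) is filled, in any order, with the elements of $[n]\setminus\{\Theta(i):i\in[t]\}$, and whose remaining $t$ rows (each of length one) are filled, in any order, with the elements of $\{\Theta(i):i\in[t]\}$. Then the polynomial $\mathsf{d}^{\Theta}_F$ is invariant under the row group $\mathfrak{R}_{\tau_{\boldsymbol{\lambda}}}$, i.e. $\mathfrak{s}\,\mathsf{d}^{\Theta}_F=\mathsf{d}^{\Theta}_F$ for all $\mathfrak{s}\in\mathfrak{R}_{\tau_{\boldsymbol{\lambda}}}$.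
   Context: $\mathbb{R}[\mathbf{x}]$ denotes the polynomial ring in the $\binom{n}{2}$ variables $\mathsf{x}_{ij}$, $1\le i<j\le n$ (we write $\mathsf{x}_{ji}:=\mathsf{x}_{ij}$). The symmetric group $\mathfrak{S}_n$ acts on $\mathbb{R}[\mathbf{x}]$ by $\mathfrak{s}\,\mathsf{x}_{ij}:=\mathsf{x}_{\mathfrak{s}(i)\mathfrak{s}(j)}$, extended to monomials multiplicatively and to polynomials linearly. An intersection type of size $t$ is a graph $T$ on $t$ vertices, each labeled by a distinct element of $[t]$. For $f\ge t$, a $T$-flag of size $f$ is a graph $F$ on $f$ vertices in which $t$ vertices carry the distinct labels $1,\dots,t$ and these labeled vertices induce a copy of $T$ in $F$ with identical labels. For an injective map $h:V(F)\to[n]$ put $\mathsf{p}^h_F:=\prod_{\{u,v\}\in E(F)}\mathsf{x}_{h(u)h(v)}\prod_{\{u,v\}\in\binom{V(F)}{2}\setminus E(F)}(1-\mathsf{x}_{h(u)h(v)})$. For an injective $\Theta:[t]\to[n]$, an injective map $h:V(F)\to[n]$ respects $\Theta$ if $h(v)=\Theta(i)$ for every vertex $v$ of $F$ labeled $i$; let $\mathrm{Inj}_\Theta(V(F),[n])$ be the set of such maps and define $\mathsf{d}^\Theta_F:=\frac{1}{|\mathrm{Inj}_\Theta(V(F),[n])|}\sum_{h\in\mathrm{Inj}_\Theta(V(F),[n])}\mathsf{p}^h_F$. A partition $\boldsymbol{\lambda}=(\lambda_1,\dots,\lambda_k)$ of $n$ has $\lambda_1\ge\dots\ge\lambda_k>0$,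 $\sum\lambda_i=n$; $(n-t,1^t)$ denotes the hook partition with one part $n-t$ and $t$ parts equal to $1$. A tableau of shape $\boldsymbol{\lambda}$ is a filling of the Young diagram of $\boldsymbol{\lambda}$ (rows of lengths $\lambda_1,\dots,\lambda_k$) with the numbers $1,\dots,n$, each used once. Its row group $\mathfrak{R}_{\tau_{\boldsymbol{\lambda}}}$ is the subgroup of $\mathfrak{S}_n$ of permutations that map the set of entries of each row to itself. -}

module Defs where

open import Data.Bool using (Bool; true; false; if_then_else_)
open import Data.Nat as ℕ using (ℕ; zero; suc; _∸_)
open import Data.Fin as Fin using (Fin; zero; suc)
open import Data.Fin.Properties using (all?; _≟_)
open import Data.Fin.Permutation using (Permutation′; _⟨$⟩ʳ_)
open import Data.List using (List; []; _∷_; [_]; map; concatMap; filter; foldr; length; replicate; concat; allFin)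
open import Data.List.Membership.Propositional using (_∈_)
open import Data.List.Relation.Binary.Permutation.Propositional using (_↭_)
open import Data.Product using (Σ; ∃; _×_; _,_)
open import Data.Rational as ℚ using (ℚ; 0ℚ; 1ℚ)
open import Data.Integer using (+_)
open import Function.Bundles using (_⇔_)
open import Relation.Binary.PropositionalEquality using (_≡_)
open import Relation.Nullary using (¬_)
open import Relation.Nullary.Decidable using (_×-dec_; _→-dec_)

-- Polynomials in the variables x_ij (i, j ∈ [n]) with rational coefficients.
-- x_ji = x_ij is imposed by only evaluating at symmetric assignments
-- (see _≈ₚ_).  Diagonal variables x_ii are never used.

data Poly (n : ℕ) : Set where
  var  : Fin n → Fin n → Poly n
  con  : ℚ → Poly n
  _⊕_  : Poly n → Poly n → Poly n
  _⊗_  : Poly n → Poly n → Poly n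

Assignment : ℕ → Set
Assignment n = Fin n → Fin n → ℚ

Symmetric : ∀ {n} → Assignment n → Set
Symmetric a = ∀ i j → a i j ≡ a j i

⟦_⟧ : ∀ {n} → Poly n → Assignment n → ℚ
⟦ var i j ⟧ a = a i j
⟦ con c ⟧   a = c
⟦ p ⊕ q ⟧   a = ⟦ p ⟧ a ℚ.+ ⟦ q ⟧ a
⟦ p ⊗ q ⟧   a = ⟦ p ⟧ a ℚ.* ⟦ q ⟧ a

-- equality in the polynomial ring ℚ[x_ij : i<j]
-- (polynomial identity = identity of polynomial functions over the infinite field ℚ)
_≈ₚ_ : ∀ {n} → Poly n → Poly n → Set
_≈ₚ_ {n} p q = (a : Assignment n) → Symmetric a → ⟦ p ⟧ a ≡ ⟦ q ⟧ a

_·_ : ∀ {n} → Permutation′ n → Poly n → Poly n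
s · var i j = var (s ⟨$⟩ʳ i) (s ⟨$⟩ʳ j)
s · con c   = con c
s · (p ⊕ q) = (s · p) ⊕ (s · q)
s · (p ⊗ q) = (s · p) ⊗ (s · q)

sumP : ∀ {n} → List (Poly n) → Poly n
sumP = foldr _⊕_ (con 0ℚ)

prodP : ∀ {n} → List (Poly n) → Poly n
prodP = foldr _⊗_ (con 1ℚ)

record Graph (v : ℕ) : Set where
  field
    adj    : Fin v → Fin v → Bool
    sym    : ∀ u w → adj u w ≡ adj w u
    irrefl : ∀ u → adj u u ≡ false
open Graph public

-- intersection type of size t: a graph on [t] (vertex i carries label i)
Type : ℕ → Set
Type t = Graph t

record Flag {t : ℕ} (T : Type t) (f : ℕ) : Set where
  field
    graph   : Graph f
    lab     : Fin t → Fin f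
    lab-inj : ∀ i j → lab i ≡ lab j → i ≡ j
    induces : ∀ i j → adj graph (lab i) (lab j) ≡ adj T i j
open Flag public

pairs : (f : ℕ) → List (Fin f × Fin f)
pairs f = filter (λ { (u , w) → u Fin.<? w })
                 (concatMap (λ u → map (λ w → (u , w)) (allFin f)) (allFin f))

pF : ∀ {n f} → Graph f → (Fin f → Fin n) → Poly n
pF G h = prodP (map (λ { (u , w) → if adj G u w
                                     then var (h u) (h w)
                                     else (con 1ℚ ⊕ (con (ℚ.- 1ℚ) ⊗ var (h u) (h w))) })
                    (pairs _))

allFuns : (f n : ℕ) → List (Fin f → Fin n)
allFuns zero    n = [ (λ ()) ]
allFuns (suc f) n = concatMap (λ a → map (λ g → λ { zero → a ; (suc k) → g k }) (allFuns f n))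
                              (allFin n)

IsInjective : ∀ {f n} → (Fin f → Fin n) → Set
IsInjective h = ∀ u w → h u ≡ h w → u ≡ w

Respects : ∀ {t f n} → (Fin t → Fin f) → (Fin t → Fin n) → (Fin f → Fin n) → Set
Respects lab Θ h = ∀ i → h (lab i) ≡ Θ i

InjΘ : ∀ {t f n} → (Fin t → Fin f) → (Fin t → Fin n) → List (Fin f → Fin n)
InjΘ {f = f} {n} lab Θ =
  filter (λ h → all? (λ u → all? (λ w → (h u ≟ h w) →-dec (u ≟ w)))
                ×-dec all? (λ i → h (lab i) ≟ Θ i))
         (allFuns f n)

-- 1 / |L|  (the list is nonempty whenever f ≤ n; value 0 otherwise)
invLen : ∀ {A : Set} → List A → ℚ
invLen []       = 0ℚ
invLen (_ ∷ xs) = (+ 1) ℚ./ suc (length xs)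

dF : ∀ {t f n} {T : Type t} → Flag T f → (Fin t → Fin n) → Poly n
dF F Θ = con (invLen (InjΘ (lab F) Θ)) ⊗ sumP (map (pF (graph F)) (InjΘ (lab F) Θ))

record Tableau (n : ℕ) (shape : List ℕ) : Set where
  field
    rows      : List (List (Fin n))
    rowLens   : map length rows ≡ shape
    bijective : concat rows ↭ allFin n
open Tableau public

InRowGroup : ∀ {n sh} → Tableau n sh → Permutation′ n → Set
InRowGroup τ s = ∀ r → r ∈ rows τ → ∀ e → e ∈ r → (s ⟨$⟩ʳ e) ∈ r

hook : ℕ → ℕ → List ℕ
hook n t = (n ∸ t) ∷ replicate t 1

Adapted : ∀ {n t} → (Fin t → Fin n) → Tableau n (hook n t) → Set
Adapted {n} {t} Θ τ = Σ (List (Fin n)) λ r₀ → Σ (List (List (Fin n))) λ rs →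
    (rows τ ≡ r₀ ∷ rs)
  × (∀ k → (k ∈ r₀) ⇔ (¬ ∃ λ i → Θ i ≡ k))
  × (concat rs ↭ map Θ (allFin t))

{-# OPTIONS --safe #-}
-- Every Θ i fills a row of length one, so each s in the row group fixes Θ pointwise. Hence
-- h ↦ s ∘ h permutes Inj_Θ(V(F),[n]), and since s · p^h_F = p^{s∘h}_F, the action of s only
-- reorders the summands of d^Θ_F. Without function extensionality this reindexing is done for
-- summands respecting ≗: first over all maps Fin f → Fin n, by induction on f (each new
-- coordinate is permuted by s), then restricted to Inj_Θ through its decidable predicate.
module Submission where

open import Defs hiding (sym)
open import Data.Nat using (ℕ; _≤_; zero; suc)
open import Data.Fin using (Fin; zero; suc)
open import Data.Fin.Permutation using (Permutation′; _⟨$⟩ʳ_)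
open import Data.Bool using (if_then_else_)
open import Data.Bool.Properties using (if-float)
open import Data.List using (List; []; _∷_; _++_; length; replicate; map; concatMap; filter; tabulate; allFin)
open import Data.List.Properties using (map-cong; ∷-injectiveʳ)
open import Data.List.Relation.Unary.All using (All)
import Data.List.Relation.Unary.All as All
open import Data.List.Relation.Unary.All.Properties using (map⁻; replicate⁺)
open import Data.List.Relation.Unary.Any using (here; there)
open import Data.List.Membership.Propositional using (_∈_)
open import Data.List.Membership.Propositional.Properties using (∈-map⁺; ∈-concat⁻′; ∈-allFin)
open import Data.List.Relation.Binary.Permutation.Propositional using (↭-sym)
open import Data.List.Relation.Binary.Permutation.Propositional.Properties using (∈-resp-↭)
open import Data.Product using (_,_)
import Data.Product as Product
open import Data.Product.Function.NonDependent.Propositional using (_×-⇔_)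
import Data.Vec.Functional as Vector
open import Data.Vec.Functional.Properties using (∷-cong)
open import Data.Rational as ℚ using (ℚ; 0ℚ; 1ℚ)
open import Data.Rational.Properties using (+-assoc; +-identityˡ; +-0-commutativeMonoid)
open import Algebra.Properties.CommutativeMonoid.Sum +-0-commutativeMonoid using (sum; sum-permute)
open import Function using (id; _∘_; _⇔_; mk⇔)
open import Function.Definitions using (Congruent)
open import Function.Properties.Inverse using (↔⇒↣)
open import Function.Bundles using (Injection)
open import Relation.Binary.PropositionalEquality
  using (_≡_; _≗_; refl; sym; trans; cong; cong₂; subst; module ≡-Reasoning)
open import Relation.Nullary using (Dec; yes; no; does)
open import Relation.Nullary.Decidable using (does-⇔)

∑ : {A : Set} → List A → (A → ℚ) → ℚ
∑ []       Ψ = 0ℚ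
∑ (x ∷ xs) Ψ = Ψ x ℚ.+ ∑ xs Ψ

∑-cong : {A : Set} (xs : List A) {Ψ Φ : A → ℚ} → Ψ ≗ Φ → ∑ xs Ψ ≡ ∑ xs Φ
∑-cong []       Ψ≗Φ = refl
∑-cong (x ∷ xs) Ψ≗Φ = cong₂ ℚ._+_ (Ψ≗Φ x) (∑-cong xs Ψ≗Φ)

∑-++ : {A : Set} (xs ys : List A) (Ψ : A → ℚ) → ∑ (xs ++ ys) Ψ ≡ ∑ xs Ψ ℚ.+ ∑ ys Ψ
∑-++ []       ys Ψ = sym (+-identityˡ _)
∑-++ (x ∷ xs) ys Ψ = trans (cong (Ψ x ℚ.+_) (∑-++ xs ys Ψ)) (sym (+-assoc (Ψ x) _ _))

∑-concatMap : {A B : Set} (k : A → List B) (xs : List A) (Ψ : B → ℚ) →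
              ∑ (concatMap k xs) Ψ ≡ ∑ xs (λ x → ∑ (k x) Ψ)
∑-concatMap k []       Ψ = refl
∑-concatMap k (x ∷ xs) Ψ =
  trans (∑-++ (k x) (concatMap k xs) Ψ) (cong (∑ (k x) Ψ ℚ.+_) (∑-concatMap k xs Ψ))

∑-map : {A B : Set} (g : A → B) (xs : List A) (Ψ : B → ℚ) → ∑ (map g xs) Ψ ≡ ∑ xs (Ψ ∘ g)
∑-map g []       Ψ = refl
∑-map g (x ∷ xs) Ψ = cong (Ψ (g x) ℚ.+_) (∑-map g xs Ψ)

∑-filter : {A : Set} {P : A → Set} (P? : ∀ x → Dec (P x)) (xs : List A) (Ψ : A → ℚ) →
           ∑ (filter P? xs) Ψ ≡ ∑ xs (λ x → if does (P? x) then Ψ x else 0ℚ)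
∑-filter P? []       Ψ = refl
∑-filter P? (x ∷ xs) Ψ with P? x
... | yes _ = cong (Ψ x ℚ.+_) (∑-filter P? xs Ψ)
... | no  _ = trans (∑-filter P? xs Ψ) (sym (+-identityˡ _))

∑-tabulate : ∀ {m n} (g : Fin m → Fin n) (Φ : Fin n → ℚ) → ∑ (tabulate g) Φ ≡ sum (Φ ∘ g)
∑-tabulate {zero}  g Φ = refl
∑-tabulate {suc m} g Φ = cong (Φ (g zero) ℚ.+_) (∑-tabulate (g ∘ suc) Φ)

∑-allFin-permute : ∀ {n} (s : Permutation′ n) (Φ : Fin n → ℚ) →
                   ∑ (allFin n) (Φ ∘ (s ⟨$⟩ʳ_)) ≡ ∑ (allFin n) Φ
∑-allFin-permute {n} s Φ = begin
  ∑ (allFin n) (Φ ∘ (s ⟨$⟩ʳ_)) ≡⟨ ∑-tabulate id (Φ ∘ (s ⟨$⟩ʳ_)) ⟩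
  sum (Φ ∘ (s ⟨$⟩ʳ_))          ≡⟨ sum-permute Φ s ⟨
  sum Φ                        ≡⟨ ∑-tabulate id Φ ⟨
  ∑ (allFin n) Φ               ∎
  where open ≡-Reasoning

-- allFuns builds a ∷ g with its own pattern lambda, equal to a ∷ g only pointwise.
∑-allFuns-suc : ∀ {f n} (Ψ : (Fin (suc f) → Fin n) → ℚ) → Congruent _≗_ _≡_ Ψ →
  ∑ (allFuns (suc f) n) Ψ ≡ ∑ (allFin n) (λ a → ∑ (allFuns f n) (λ g → Ψ (a Vector.∷ g)))
∑-allFuns-suc {f} {n} Ψ Ψ-cong =
  trans (∑-concatMap _ (allFin n) Ψ) (∑-cong (allFin n) λ a →
  trans (∑-map _ (allFuns f n) Ψ) (∑-cong (allFuns f n) λ g →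
  Ψ-cong (∷-cong refl λ _ → refl)))

isInjective-resp-≗ : ∀ {f n} {h h' : Fin f → Fin n} → h ≗ h' → IsInjective h → IsInjective h'
isInjective-resp-≗ h≗h' inj u w h'u≡h'w = inj u w (trans (h≗h' u) (trans h'u≡h'w (sym (h≗h' w))))

respects-resp-≗ : ∀ {t f n} (lab : Fin t → Fin f) (Θ : Fin t → Fin n) {h h' : Fin f → Fin n} →
                  h ≗ h' → Respects lab Θ h → Respects lab Θ h'
respects-resp-≗ lab Θ h≗h' resp i = trans (sym (h≗h' (lab i))) (resp i)

module _ {n : ℕ} (s : Permutation′ n) where

  private
    σ : Fin n → Fin n
    σ = s ⟨$⟩ʳ_

  σ-injective : ∀ {i j} → σ i ≡ σ j → i ≡ j
  σ-injective = Injection.injective (↔⇒↣ s)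

  ∑-allFuns-postcompose : ∀ f (Ψ : (Fin f → Fin n) → ℚ) → Congruent _≗_ _≡_ Ψ →
    ∑ (allFuns f n) (λ h → Ψ (σ ∘ h)) ≡ ∑ (allFuns f n) Ψ
  ∑-allFuns-postcompose zero    Ψ Ψ-cong = cong (ℚ._+ 0ℚ) (Ψ-cong λ ())
  ∑-allFuns-postcompose (suc f) Ψ Ψ-cong = begin
    ∑ (allFuns (suc f) n) (λ h → Ψ (σ ∘ h))
      ≡⟨ ∑-allFuns-suc (λ h → Ψ (σ ∘ h)) (λ h≗h' → Ψ-cong (cong σ ∘ h≗h')) ⟩
    ∑ (allFin n) (λ a → ∑ (allFuns f n) (λ g → Ψ (σ ∘ (a Vector.∷ g))))
      ≡⟨ ∑-cong (allFin n) (λ a → ∑-cong (allFuns f n) λ g → Ψ-cong (∷-cong refl λ _ → refl)) ⟩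
    ∑ (allFin n) (λ a → ∑ (allFuns f n) (λ g → Ψ (σ a Vector.∷ σ ∘ g)))
      ≡⟨ ∑-cong (allFin n) (λ a → ∑-allFuns-postcompose f (λ g → Ψ (σ a Vector.∷ g)) (Ψ-cong ∘ ∷-cong refl)) ⟩
    ∑ (allFin n) (λ a → ∑ (allFuns f n) (λ g → Ψ (σ a Vector.∷ g)))
      ≡⟨ ∑-allFin-permute s (λ b → ∑ (allFuns f n) (λ g → Ψ (b Vector.∷ g))) ⟩
    ∑ (allFin n) (λ a → ∑ (allFuns f n) (λ g → Ψ (a Vector.∷ g)))
      ≡⟨ ∑-allFuns-suc Ψ Ψ-cong ⟨
    ∑ (allFuns (suc f) n) Ψ ∎
    where open ≡-Reasoning

  ∑-filter-postcompose : ∀ {f} {P : (Fin f → Fin n) → Set} (P? : ∀ h → Dec (P h)) →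
    (∀ {h h'} → h ≗ h' → P h → P h') → (∀ h → P (σ ∘ h) ⇔ P h) →
    (Ψ : (Fin f → Fin n) → ℚ) → Congruent _≗_ _≡_ Ψ →
    ∑ (filter P? (allFuns f n)) (λ h → Ψ (σ ∘ h)) ≡ ∑ (filter P? (allFuns f n)) Ψ
  ∑-filter-postcompose {f} P? P-resp P∘σ⇔P Ψ Ψ-cong = begin
    ∑ (filter P? (allFuns f n)) (λ h → Ψ (σ ∘ h))
      ≡⟨ ∑-filter P? (allFuns f n) (λ h → Ψ (σ ∘ h)) ⟩
    ∑ (allFuns f n) (λ h → if does (P? h) then Ψ (σ ∘ h) else 0ℚ)
      ≡⟨ ∑-cong (allFuns f n) (λ h → cong (λ b → if b then Ψ (σ ∘ h) else 0ℚ)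
                                          (does-⇔ (P∘σ⇔P h) (P? (σ ∘ h)) (P? h))) ⟨
    ∑ (allFuns f n) (λ h → χ (σ ∘ h))
      ≡⟨ ∑-allFuns-postcompose f χ χ-cong ⟩
    ∑ (allFuns f n) χ
      ≡⟨ ∑-filter P? (allFuns f n) Ψ ⟨
    ∑ (filter P? (allFuns f n)) Ψ ∎
    where
    open ≡-Reasoning
    χ : (Fin f → Fin n) → ℚ
    χ h = if does (P? h) then Ψ h else 0ℚ
    χ-cong : Congruent _≗_ _≡_ χ
    χ-cong {h} {h'} h≗h' =
      cong₂ (λ b x → if b then x else 0ℚ)
            (does-⇔ (mk⇔ (P-resp h≗h') (P-resp (sym ∘ h≗h'))) (P? h) (P? h'))
            (Ψ-cong h≗h')

  isInjective-postcompose : ∀ {f} (h : Fin f → Fin n) → IsInjective (σ ∘ h) ⇔ IsInjective h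
  isInjective-postcompose h =
    mk⇔ (λ inj u w hu≡hw → inj u w (cong σ hu≡hw))
        (λ inj u w σhu≡σhw → inj u w (σ-injective σhu≡σhw))

  respects-postcompose : ∀ {t f} (lab : Fin t → Fin f) (Θ : Fin t → Fin n) →
    (∀ i → σ (Θ i) ≡ Θ i) → ∀ h → Respects lab Θ (σ ∘ h) ⇔ Respects lab Θ h
  respects-postcompose lab Θ σΘ≡Θ h =
    mk⇔ (λ resp i → σ-injective (trans (resp i) (sym (σΘ≡Θ i))))
        (λ resp i → trans (cong σ (resp i)) (σΘ≡Θ i))

  ∑-InjΘ-postcompose : ∀ {t f} (lab : Fin t → Fin f) (Θ : Fin t → Fin n) →
    (∀ i → σ (Θ i) ≡ Θ i) → (Ψ : (Fin f → Fin n) → ℚ) → Congruent _≗_ _≡_ Ψ →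
    ∑ (InjΘ lab Θ) (λ h → Ψ (σ ∘ h)) ≡ ∑ (InjΘ lab Θ) Ψ
  ∑-InjΘ-postcompose lab Θ σΘ≡Θ =
    ∑-filter-postcompose _
      (λ h≗h' → Product.map (isInjective-resp-≗ h≗h') (respects-resp-≗ lab Θ h≗h'))
      (λ h → isInjective-postcompose h ×-⇔ respects-postcompose lab Θ σΘ≡Θ h)

  ·-sumP-map : {A : Set} (g : A → Poly n) (xs : List A) →
               s · sumP (map g xs) ≡ sumP (map (λ x → s · g x) xs)
  ·-sumP-map g []       = refl
  ·-sumP-map g (x ∷ xs) = cong ((s · g x) ⊕_) (·-sumP-map g xs)

  ·-prodP-map : {A : Set} (g : A → Poly n) (xs : List A) →
                s · prodP (map g xs) ≡ prodP (map (λ x → s · g x) xs)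
  ·-prodP-map g []       = refl
  ·-prodP-map g (x ∷ xs) = cong ((s · g x) ⊗_) (·-prodP-map g xs)

  ·-pF : ∀ {f} (G : Graph f) (h : Fin f → Fin n) → s · pF G h ≡ pF G (σ ∘ h)
  ·-pF {f} G h = trans (·-prodP-map _ (pairs f))
    (cong prodP (map-cong (λ { (u , w) → if-float (s ·_) (adj G u w) }) (pairs f)))

pF-cong : ∀ {f n} (G : Graph f) {h h' : Fin f → Fin n} → h ≗ h' → pF G h ≡ pF G h'
pF-cong {f} G h≗h' = cong prodP (map-cong (λ { (u , w) →
  cong₂ (λ i j → if adj G u w then var i j else (con 1ℚ ⊕ (con (ℚ.- 1ℚ) ⊗ var i j)))
        (h≗h' u) (h≗h' w) }) (pairs f))

⟦sumP-map⟧ : ∀ {n} {A : Set} (g : A → Poly n) (xs : List A) (a : Assignment n) →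
             ⟦ sumP (map g xs) ⟧ a ≡ ∑ xs (λ x → ⟦ g x ⟧ a)
⟦sumP-map⟧ g []       a = refl
⟦sumP-map⟧ g (x ∷ xs) a = cong (⟦ g x ⟧ a ℚ.+_) (⟦sumP-map⟧ g xs a)

dF-invariant : ∀ {t f n} {T : Type t} (F : Flag T f) (Θ : Fin t → Fin n) (s : Permutation′ n) →
               (∀ i → s ⟨$⟩ʳ Θ i ≡ Θ i) → (s · dF F Θ) ≈ₚ dF F Θ
dF-invariant {f = f} {n} F Θ s sΘ≡Θ a _ = cong (invLen L ℚ.*_) (begin
  ⟦ s · sumP (map (pF G) L) ⟧ a           ≡⟨ cong (λ p → ⟦ p ⟧ a) (·-sumP-map s (pF G) L) ⟩
  ⟦ sumP (map (λ h → s · pF G h) L) ⟧ a   ≡⟨ ⟦sumP-map⟧ (λ h → s · pF G h) L a ⟩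
  ∑ L (λ h → ⟦ s · pF G h ⟧ a)            ≡⟨ ∑-cong L (λ h → cong (λ p → ⟦ p ⟧ a) (·-pF s G h)) ⟩
  ∑ L (λ h → ⟦ pF G ((s ⟨$⟩ʳ_) ∘ h) ⟧ a)   ≡⟨ ∑-InjΘ-postcompose s (lab F) Θ sΘ≡Θ (λ h → ⟦ pF G h ⟧ a)
                                                (λ h≗h' → cong (λ p → ⟦ p ⟧ a) (pF-cong G h≗h')) ⟩
  ∑ L (λ h → ⟦ pF G h ⟧ a)                ≡⟨ ⟦sumP-map⟧ (pF G) L a ⟨
  ⟦ sumP (map (pF G) L) ⟧ a               ∎)
  where
  open ≡-Reasoning
  G : Graph f
  G = graph F
  L : List (Fin f → Fin n)
  L = InjΘ (lab F) Θ

∈-length-1-unique : {A : Set} {x y : A} (r : List A) → length r ≡ 1 → x ∈ r → y ∈ r → x ≡ y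
∈-length-1-unique (_ ∷ []) refl (here refl) (here refl) = refl

rowGroup-fixes-singletonRow : ∀ {n sh} (τ : Tableau n sh) (s : Permutation′ n) → InRowGroup τ s →
  ∀ {r} → r ∈ rows τ → length r ≡ 1 → ∀ {e} → e ∈ r → s ⟨$⟩ʳ e ≡ e
rowGroup-fixes-singletonRow τ s s∈ℜτ {r} r∈τ |r|≡1 {e} e∈r =
  ∈-length-1-unique r |r|≡1 (s∈ℜτ r r∈τ e e∈r) e∈r

hook-tail-singletons : ∀ {n t r₀ rs} (τ : Tableau n (hook n t)) → rows τ ≡ r₀ ∷ rs →
                       All (λ r → length r ≡ 1) rs
hook-tail-singletons {t = t} {rs = rs} τ rows≡ =
  map⁻ (subst (All (_≡ 1)) (sym lengths≡) (replicate⁺ t refl))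
  where
  lengths≡ : map length rs ≡ replicate t 1
  lengths≡ = ∷-injectiveʳ (trans (cong (map length) (sym rows≡)) (rowLens τ))

rowGroup-fixes-Θ : ∀ {n t} (Θ : Fin t → Fin n) (τ : Tableau n (hook n t)) → Adapted Θ τ →
  (s : Permutation′ n) → InRowGroup τ s → ∀ i → s ⟨$⟩ʳ Θ i ≡ Θ i
rowGroup-fixes-Θ Θ τ (r₀ , rs , rows≡ , _ , rs↭Θ) s s∈ℜτ i
  with ∈-concat⁻′ rs (∈-resp-↭ (↭-sym rs↭Θ) (∈-map⁺ Θ (∈-allFin i)))
... | r , Θi∈r , r∈rs =
  rowGroup-fixes-singletonRow τ s s∈ℜτ (subst (r ∈_) (sym rows≡) (there r∈rs))
    (All.lookup (hook-tail-singletons τ rows≡) r∈rs) Θi∈r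

proposition4p2 : (t f n : ℕ) → 1 ≤ t → t ≤ f → f ≤ n →
    (T : Type t) (F : Flag T f) (Θ : Fin t → Fin n) →
    (∀ i j → Θ i ≡ Θ j → i ≡ j) →
    (τ : Tableau n (hook n t)) → Adapted Θ τ →
    (s : Permutation′ n) → InRowGroup τ s →
    (s · dF F Θ) ≈ₚ dF F Θ
proposition4p2 t f n _ _ _ T F Θ _ τ adapted s s∈ℜτ =
  dF-invariant F Θ s (rowGroup-fixes-Θ Θ τ adapted s s∈ℜτ)
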